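{- Let $n\ge t\ge 2$ and let $X$ be an $n$-element set partitioned into $t-1$ parts, $X=X_1\sqcup\cdots\sqcup X_{t-1}$. For each $i$ fix a maximal chain $\mathcal{C}_i$ on $X_i$. Then the family $$\mathcal{D}(X_1,\ldots,X_{t-1})=\{C_1\sqcup\cdots\sqcup C_{t-1} : C_i\in\mathcal{C}_i\text{ for } i=1,\ldots,t-1\}$$ is not $t$-separable.
   Context: A maximal chain on a set $Y=\{y_1,\ldots,y_m\}$ (elements listed in some order) is the family $\{\emptyset,\{y_1\},\{y_1,y_2\},\ldots,\{y_1,\ldots,y_m\}\}$. A family $\mathcal{F}\subset 2^X$ is called $t$-separable if there is a $t$-element subset $T\subset X$ such that for every ordered pair $x,y\in T$ with $x\neq y$ there exists $F\in\mathcal{F}$ with $F\cap\{x,y\}=\{x\}$. -}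

module Defs where

open import Data.Nat using (ℕ; _≤_)
open import Data.Fin using (Fin)
open import Data.List using (List; take; length)
open import Data.List.Membership.Propositional using (_∈_)
open import Data.List.Relation.Unary.Unique.Propositional using (Unique)
open import Data.Product using (Σ; ∃; _×_; _,_)
open import Function.Bundles using (_⇔_)
open import Function.Definitions using (Injective)
open import Relation.Binary.PropositionalEquality using (_≡_; _≢_)
open import Relation.Nullary using (¬_)

-- Ground set X = Fin n. A subset of X is a predicate on Fin n.
Subset : ℕ → Set₁
Subset n = Fin n → Set

-- A maximal chain on Y ⊆ X is given by an enumeration y₁,…,y_m of Y
-- (a duplicate-free list whose elements are exactly those of Y);
-- its members are the prefix sets {y₁,…,y_k}, 0 ≤ k ≤ m.
record Enumeration {n : ℕ} (Y : Fin n → Set) : Set where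
  field
    elems  : List (Fin n)
    unique : Unique elems
    exact  : ∀ x → (x ∈ elems) ⇔ Y x
open Enumeration public

chainMember : ∀ {n} {Y : Fin n → Set} → Enumeration Y → ℕ → Subset n
chainMember e k x = x ∈ take k (elems e)

Separable : ∀ {n} (t : ℕ) {I : Set} → (I → Subset n) → Set
Separable {n} t {I} 𝓕 =
  Σ (Fin t → Fin n) λ T → Injective _≡_ _≡_ T ×
    (∀ a b → a ≢ b → ∃ λ (j : I) → 𝓕 j (T a) × ¬ 𝓕 j (T b))

-- The family D(X₁,…,X_{s}) for a partition given by p : Fin n → Fin s
-- (X_i = p⁻¹(i)) and chains given by enumerations C i of X_i.
-- Members are indexed by a choice of prefix length k i ≤ |X_i| for each i;
-- the member is the union ⋃_i C_i(k i).
DIndex : ∀ {n s} (p : Fin n → Fin s) → ((i : Fin s) → Enumeration (λ x → p x ≡ i)) → Set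
DIndex {s = s} p C = Σ (Fin s → ℕ) λ k → ∀ i → k i ≤ length (elems (C i))

DFamily : ∀ {n s} (p : Fin n → Fin s) (C : (i : Fin s) → Enumeration (λ x → p x ≡ i)) →
          DIndex p C → Subset n
DFamily {s = s} p C (k , _) x = ∃ λ (i : Fin s) → chainMember (C i) (k i) x

-- Two of the t points of T lie in the same part X_i, by pigeonhole.  Every
-- member of D meets X_i in a member of the chain C_i, and members of a chain
-- are nested: the point appearing earlier in the enumeration of X_i belongs
-- to every member containing the later one, so those two points cannot be
-- separated in both directions.
module Submission where

open import Defs
open import Data.Nat using (ℕ; _≤_; _∸_; suc; s≤s)
open import Data.Nat.Properties using (n<1+n)
open import Data.Fin using (Fin; _≟_)
open import Data.Fin.Properties using (pigeonhole; <⇒≢)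
open import Data.Empty using (⊥-elim)
open import Data.List using (List; _∷_; take)
open import Data.List.Membership.Propositional using (_∈_)
open import Data.List.Relation.Unary.Any using (here; there; tail)
open import Data.List.Relation.Binary.Sublist.Propositional using (lookup)
open import Data.List.Relation.Binary.Sublist.Propositional.Properties using (take-⊆)
open import Data.Product using (∃; _×_; _,_; proj₁)
open import Data.Sum using (_⊎_; inj₁; inj₂)
import Data.Sum as Sum
open import Function.Base using (_∘_)
open import Function.Bundles using (Equivalence)
open import Function.Definitions using (Surjective)
open import Relation.Binary.Definitions using (DecidableEquality)
open import Relation.Binary.PropositionalEquality using (_≡_; _≢_; refl; sym; trans; subst)
open import Relation.Nullary using (¬_; yes; no)

module _ {a} {A : Set a} where

  PrecedesIn : List A → A → A → Set a
  PrecedesIn xs x y = ∀ k → y ∈ take k xs → x ∈ take k xs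

  head-precedesIn : ∀ {z y : A} {zs} → PrecedesIn (z ∷ zs) z y
  head-precedesIn (suc k) _ = here refl

  ∷-precedesIn : ∀ {x y z : A} {zs} → y ≢ z → PrecedesIn zs x y → PrecedesIn (z ∷ zs) x y
  ∷-precedesIn y≢z x≼y (suc k) (here y≡z) = ⊥-elim (y≢z y≡z)
  ∷-precedesIn y≢z x≼y (suc k) (there y∈) = there (x≼y k y∈)

  precedesIn-total : DecidableEquality A → ∀ {x y : A} xs → x ∈ xs → y ∈ xs →
                     PrecedesIn xs x y ⊎ PrecedesIn xs y x
  precedesIn-total _≟A_ {x} {y} (z ∷ zs) x∈ y∈ with x ≟A z | y ≟A z
  ... | yes refl | _        = inj₁ head-precedesIn
  ... | no _     | yes refl = inj₂ head-precedesIn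
  ... | no x≢z   | no y≢z   =
    Sum.map (∷-precedesIn y≢z) (∷-precedesIn x≢z)
            (precedesIn-total _≟A_ zs (tail x≢z x∈) (tail y≢z y∈))

module _ {n s} (p : Fin n → Fin s) (C : (i : Fin s) → Enumeration (λ x → p x ≡ i)) where

  SeparatesFrom : Fin n → Fin n → Set
  SeparatesFrom u v = ∃ λ j → DFamily p C j u × ¬ DFamily p C j v

  ∈-elems : ∀ {u i} → p u ≡ i → u ∈ elems (C i)
  ∈-elems {u} {i} = Equivalence.from (exact (C i) u)

  DFamily⇒chainMember : ∀ {u i} (j : DIndex p C) → p u ≡ i → DFamily p C j u →
                        chainMember (C i) (proj₁ j i) u
  DFamily⇒chainMember {u} (k , _) pu≡i (i′ , u∈) =
    subst (λ r → chainMember (C r) (k r) u) (trans (sym pu≡i′) pu≡i) u∈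
    where
    pu≡i′ : p u ≡ i′
    pu≡i′ = Equivalence.to (exact (C i′) u) (lookup (take-⊆ (k i′) _) u∈)

  precedesIn⇒¬separatesFrom : ∀ {x y i} → p y ≡ i →
                              PrecedesIn (elems (C i)) x y → ¬ SeparatesFrom y x
  precedesIn⇒¬separatesFrom {i = i} py≡i x≼y (j , y∈Dj , x∉Dj) =
    x∉Dj (i , x≼y (proj₁ j i) (DFamily⇒chainMember j py≡i y∈Dj))

  samePart⇒¬separated : ∀ {u v} → p u ≡ p v → ¬ (SeparatesFrom u v × SeparatesFrom v u)
  samePart⇒¬separated {u} {v} pu≡pv (u∖v , v∖u) with
    precedesIn-total _≟_ (elems (C (p u))) (∈-elems refl) (∈-elems (sym pu≡pv))
  ... | inj₁ u≼v = precedesIn⇒¬separatesFrom (sym pu≡pv) u≼v v∖u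
  ... | inj₂ v≼u = precedesIn⇒¬separatesFrom refl v≼u u∖v

lemma10 : (n t : ℕ) → 2 ≤ t → t ≤ n →
    (p : Fin n → Fin (t ∸ 1)) → Surjective _≡_ _≡_ p →
    (C : (i : Fin (t ∸ 1)) → Enumeration (λ x → p x ≡ i)) →
    ¬ Separable t (DFamily p C)
lemma10 n (suc t) (s≤s _) _ p _ C (T , _ , separates)
  with pigeonhole (n<1+n t) (λ a → p (T a))
... | a , b , a<b , pTa≡pTb =
  samePart⇒¬separated p C pTa≡pTb (separates a b a≢b , separates b a (a≢b ∘ sym))
  where
  a≢b : a ≢ b
  a≢b = <⇒≢ a<b
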